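{- Let $n,a,b$ be positive integers. If $a<\frac{n}{2}$ and $b\ge n-2$, then the $(a:b)$ Maker-Breaker Connectivity game $\mathcal{T}_n$ is Breaker's win.
   Context: In the $(a:b)$ Maker-Breaker Connectivity game $\mathcal{T}_n$, the board is the edge set of the complete graph $K_n$. Two players, Maker and Breaker, alternately claim previously unclaimed edges, Breaker going first; in each turn Breaker claims $b$ edges and then Maker claims $a$ edges, until every edge is claimed. Maker wins if, by the end of the game, the graph of his edges is a connected spanning subgraph of $K_n$; otherwise Breaker wins. The game is Breaker's win if Breaker has a strategy that wins against every strategy of Maker. -}

module Defs where

open import Data.Nat using (ℕ; _<_; _≤_)
open import Data.Fin using (Fin; toℕ)
open import Data.Product using (_×_; _,_)
open import Data.Sum using (_⊎_)
open import Data.List using (List; []; _∷_; _++_; length)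
open import Data.List.Membership.Propositional using (_∈_; _∉_)
open import Data.List.Relation.Unary.All using (All)
open import Data.List.Relation.Unary.Unique.Propositional using (Unique)
open import Relation.Nullary using (¬_)
open import Relation.Binary.PropositionalEquality using (_≡_)

-- An edge of K_n is an unordered pair {i , j} of distinct vertices,
-- represented canonically as the ordered pair (i , j) with i < j.
Pair : ℕ → Set
Pair n = Fin n × Fin n

IsEdge : ∀ {n} → Pair n → Set
IsEdge (i , j) = toℕ i < toℕ j

Free : ∀ {n} → List (Pair n) → List (Pair n) → Pair n → Set
Free M B e = IsEdge e × (e ∉ M) × (e ∉ B)

Full : ∀ {n} → List (Pair n) → List (Pair n) → Set
Full {n} M B = (e : Pair n) → ¬ Free M B e

ValidMove : ∀ {n} → ℕ → List (Pair n) → List (Pair n) → List (Pair n) → Set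
ValidMove {n} k M B X =
  Unique X × All (Free M B) X ×
  (length X ≡ k ⊎ (length X < k × ((e : Pair n) → Free M B e → e ∈ X)))

data Reach {n : ℕ} (M : List (Pair n)) : Fin n → Fin n → Set where
  here  : ∀ {u} → Reach M u u
  fwd   : ∀ {u v w} → (u , v) ∈ M → Reach M v w → Reach M u w
  bwd   : ∀ {u v w} → (v , u) ∈ M → Reach M v w → Reach M u w

Connected : ∀ {n} → List (Pair n) → Set
Connected {n} M = (u v : Fin n) → Reach M u v

-- Winning positions for Breaker in the (a:b) game on K_n
-- (least fixed point: Breaker has a strategy winning against every Maker strategy).
mutual
  data BreakerToMove {n : ℕ} (a b : ℕ) (M B : List (Pair n)) : Set where
    endB  : Full M B → ¬ Connected M → BreakerToMove a b M B
    moveB : ¬ Full M B → (X : List (Pair n)) → ValidMove b M B X →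
            MakerToMove a b M (X ++ B) → BreakerToMove a b M B

  data MakerToMove {n : ℕ} (a b : ℕ) (M B : List (Pair n)) : Set where
    endM  : Full M B → ¬ Connected M → MakerToMove a b M B
    allM  : ¬ Full M B →
            ((Y : List (Pair n)) → ValidMove a M B Y → BreakerToMove a b (Y ++ M) B) →
            MakerToMove a b M B

BreakerWins : ℕ → ℕ → ℕ → Set
BreakerWins n a b = BreakerToMove {n} a b [] []

-- Breaker first claims the n - 2 edges {0,k} with k ≥ 2. Maker's a edges then
-- touch at most 2a < n vertices, so some vertex u carries no Maker edge; if u = 1,
-- then 0 carries none either, since {0,1} is the only edge at 0 Maker can own.
-- As Breaker already owns {0,u} (for u ≥ 2), resp. every edge at 0 but {0,1},
-- at most n - 2 ≤ b edges at u are still free. Breaker claims them all, after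
-- which u is isolated in Maker's graph whatever happens for the rest of the game.
module Submission where

open import Defs
open import Data.Nat using (ℕ; zero; suc; _<_; _≤_; _*_; _+_; _∸_; _⊓_; z≤n; s≤s; _<?_; _≤?_)
open import Data.Nat.Properties
  using (≤∧≢⇒<; ≤-pred; ≤-trans; ≤-reflexive; ≤-<-trans; <⇒≤; ≰⇒>; <-irrefl; <-asym; *-suc;
         *-monoʳ-≤; +-monoʳ-<; +-cancelʳ-≤; +-comm; m≤n⇒m⊓n≡m; m≥n⇒m⊓n≡n; m+[n∸m]≡n)
open import Data.Nat.Induction using (<-wellFounded)
open import Induction.WellFounded using (Acc; acc)
open import Data.Fin using (Fin; zero; suc; toℕ; _≟_)
open import Data.Fin.Properties using (¬∀⟶∃¬; pigeonhole; <⇒≢; suc-injective)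
open import Data.Product using (∃; _×_; _,_; proj₁; proj₂)
open import Data.Product.Properties using (≡-dec)
open import Data.Sum using (_⊎_; inj₁; inj₂)
open import Data.Empty using (⊥-elim)
open import Data.List
  using (List; []; _∷_; _++_; length; filter; take; map; tabulate; lookup; allFin; cartesianProduct)
open import Data.List.Properties using (length-++; length-take; take-all; length-map; length-tabulate; length-filter; filter-notAll)
open import Data.List.Membership.Propositional using (_∈_; _∉_)
open import Data.List.Membership.Propositional.Properties
  using (∈-map⁺; ∈-++⁺ˡ; ∈-++⁺ʳ; ∈-filter⁺; ∈-filter⁻; ∈-tabulate⁺; ∈-allFin; ∈-cartesianProduct⁺)
open import Data.List.Relation.Binary.Pointwise using (Pointwise-≡⇒≡)
open import Data.List.Relation.Binary.Sublist.Propositional as Sublist using (⊆-refl)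
open import Data.List.Relation.Binary.Sublist.Heterogeneous.Properties
  using (⊆-filter-Sublist; length-mono-≤; toPointwise)
open import Data.List.Relation.Unary.Any using (here; there; any?; index)
import Data.List.Relation.Unary.Any as Any
open import Data.List.Relation.Unary.Any.Properties using (lookup-index)
open import Data.List.Relation.Unary.All using (All; []; _∷_)
import Data.List.Relation.Unary.All as All
import Data.List.Relation.Unary.All.Properties as Allₚ
import Data.List.Relation.Unary.AllPairs as AllPairs
open import Data.List.Relation.Unary.Unique.Propositional using (Unique)
import Data.List.Relation.Unary.Unique.Propositional.Properties as Unique
open import Function using (_∘_)
open import Relation.Binary.PropositionalEquality using (_≡_; _≢_; refl; sym; trans; cong; subst)
open import Relation.Nullary using (¬_; yes; no; ¬?)
open import Relation.Nullary.Decidable using (_×-dec_)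
open import Relation.Unary using (Pred; Decidable; _⊆_)

length-filter-< : ∀ {A : Set} {ℓ} {P Q : Pred A ℓ} (P? : Decidable P) (Q? : Decidable Q)
                  {xs : List A} {x : A} → P ⊆ Q → x ∈ xs → Q x → ¬ P x →
                  length (filter P? xs) < length (filter Q? xs)
length-filter-< P? Q? {xs} P⊆Q x∈xs Qx ¬Px = ≤∧≢⇒< (length-mono-≤ filterP⊆filterQ) λ same →
  ¬Px (proj₂ (∈-filter⁻ P? {xs = xs}
    (subst (_ ∈_) (sym (Pointwise-≡⇒≡ (toPointwise same filterP⊆filterQ))) (∈-filter⁺ Q? x∈xs Qx))))
  where
    filterP⊆filterQ : filter P? xs Sublist.⊆ filter Q? xs
    filterP⊆filterQ = ⊆-filter-Sublist P? Q? (λ { refl → P⊆Q }) (⊆-refl {x = xs})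

∃∉ : ∀ {n} (xs : List (Fin n)) → length xs < n → ∃ λ u → u ∉ xs
∃∉ {n} xs short = ¬∀⟶∃¬ n (_∈ xs) (λ u → any? (u ≟_) xs) λ every →
  let (i , j , i<j , sameIndex) = pigeonhole short (λ u → index (every u))
  in <⇒≢ i<j (trans (lookup-index (every i))
                 (trans (cong (lookup xs) sameIndex) (sym (lookup-index (every j)))))

module _ {n : ℕ} where

  open import Data.List.Membership.DecPropositional {A = Pair n} (≡-dec _≟_ _≟_) using (_∈?_)

  allPairs : List (Pair n)
  allPairs = cartesianProduct (allFin n) (allFin n)

  allPairs-unique : Unique allPairs
  allPairs-unique = Unique.cartesianProduct⁺ (Unique.allFin⁺ n) (Unique.allFin⁺ n)

  ∈-allPairs : (e : Pair n) → e ∈ allPairs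
  ∈-allPairs (i , j) = ∈-cartesianProduct⁺ (∈-allFin i) (∈-allFin j)

  Free? : (M B : List (Pair n)) → Decidable (Free M B)
  Free? M B (i , j) = (toℕ i <? toℕ j) ×-dec ¬? ((i , j) ∈? M) ×-dec ¬? ((i , j) ∈? B)

  freeEdges : List (Pair n) → List (Pair n) → List (Pair n)
  freeEdges M B = filter (Free? M B) allPairs

  full⊎free : (M B : List (Pair n)) → Full M B ⊎ ∃ (Free M B)
  full⊎free M B with any? (Free? M B) allPairs
  ... | yes some = inj₂ (Any.satisfied some)
  ... | no none  = inj₁ (λ e free → none (Any.map (λ { refl → free }) (∈-allPairs e)))

  Free-++ : ∀ {M B} (Y X : List (Pair n)) → Free (Y ++ M) (X ++ B) ⊆ Free M B
  Free-++ Y X (edge , ∉Y++M , ∉X++B) = edge , ∉Y++M ∘ ∈-++⁺ʳ Y , ∉X++B ∘ ∈-++⁺ʳ X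

  claimsFree : ∀ {k} {M B X : List (Pair n)} → ValidMove k M B X → All (Free M B) X
  claimsFree (_ , free , _) = free

  claimsAtMost : ∀ {k} {M B X : List (Pair n)} → ValidMove k M B X → length X ≤ k
  claimsAtMost (_ , _ , inj₁ exactly)    = ≤-reflexive exactly
  claimsAtMost (_ , _ , inj₂ (fewer , _)) = <⇒≤ fewer

  claimsSome : ∀ {k} {M B X : List (Pair n)} {e} → 1 ≤ k → ValidMove k M B X → Free M B e → ∃ (_∈ X)
  claimsSome                 _       (_ , _ , inj₂ (_ , all)) free = _ , all _ free
  claimsSome {X = y ∷ _}     _       (_ , _ , inj₁ _)         _    = y , here refl
  claimsSome {X = []}        (s≤s _) (_ , _ , inj₁ ())        _

  extendMove : (k : ℕ) (M B P : List (Pair n)) → Unique P → All (Free M B) P → length P ≤ k →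
               ∃ λ X → ValidMove k M B X × (∀ {e} → e ∈ P → e ∈ X)
  extendMove k M B P uniqueP freeP P≤k = P ++ T , (unique , free , size) , ∈-++⁺ˡ
    where
      Fresh? : Decidable (λ e → Free M B e × e ∉ P)
      Fresh? e = Free? M B e ×-dec ¬? (e ∈? P)
      R = filter Fresh? allPairs
      r = k ∸ length P
      T = take r R
      freshT : All (λ e → Free M B e × e ∉ P) T
      freshT = Allₚ.take⁺ r (Allₚ.all-filter Fresh? allPairs)
      unique : Unique (P ++ T)
      unique = Unique.++⁺ uniqueP (Unique.take⁺ r (Unique.filter⁺ Fresh? allPairs-unique))
                 (λ (e∈P , e∈T) → proj₂ (All.lookup freshT e∈T) e∈P)
      free : All (Free M B) (P ++ T)
      free = Allₚ.++⁺ freeP (All.map proj₁ freshT)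
      length-P++T : length (P ++ T) ≡ length P + r ⊓ length R
      length-P++T = trans (length-++ P) (cong (length P +_) (length-take r R))
      size : length (P ++ T) ≡ k ⊎ (length (P ++ T) < k × ((e : Pair n) → Free M B e → e ∈ P ++ T))
      size with r ≤? length R
      ... | yes r≤R = inj₁ (trans length-P++T
                        (trans (cong (length P +_) (m≤n⇒m⊓n≡m r≤R)) (m+[n∸m]≡n P≤k)))
      ... | no r≰R = inj₂ (fewer , everyFree)
        where
          R<r = ≰⇒> r≰R
          fewer : length (P ++ T) < k
          fewer = subst (_< k) (sym (trans length-P++T (cong (length P +_) (m≥n⇒m⊓n≡n (<⇒≤ R<r)))))
                    (subst (length P + length R <_) (m+[n∸m]≡n P≤k) (+-monoʳ-< (length P) R<r))
          everyFree : (e : Pair n) → Free M B e → e ∈ P ++ T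
          everyFree e free with e ∈? P
          ... | yes e∈P = ∈-++⁺ˡ e∈P
          ... | no e∉P  = ∈-++⁺ʳ P (subst (e ∈_) (sym (take-all r R (<⇒≤ R<r)))
                            (∈-filter⁺ Fresh? (∈-allPairs e) (free , e∉P)))

  Incident : Fin n → Pair n → Set
  Incident u (i , j) = i ≡ u ⊎ j ≡ u

  Untouched : Fin n → List (Pair n) → Set
  Untouched u = All (λ e → ¬ Incident u e)

  untouched⇒¬connected : ∀ {u v M} → Untouched u M → v ≢ u → ¬ Connected M
  untouched⇒¬connected {u} {v} untouched v≢u connected with connected u v
  ... | here          = v≢u refl
  ... | fwd u→ _      = All.lookup untouched u→ (inj₁ refl)
  ... | bwd →u _      = All.lookup untouched →u (inj₂ refl)

  endpoints : List (Pair n) → List (Fin n)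
  endpoints []            = []
  endpoints ((i , j) ∷ M) = i ∷ j ∷ endpoints M

  length-endpoints : (M : List (Pair n)) → length (endpoints M) ≡ 2 * length M
  length-endpoints []      = refl
  length-endpoints (_ ∷ M) = trans (cong (2 +_) (length-endpoints M)) (sym (*-suc 2 (length M)))

  ∉endpoints⇒untouched : ∀ {u} (M : List (Pair n)) → u ∉ endpoints M → Untouched u M
  ∉endpoints⇒untouched []            _   = []
  ∉endpoints⇒untouched ((i , j) ∷ M) u∉ =
    (λ { (inj₁ refl) → u∉ (here refl) ; (inj₂ refl) → u∉ (there (here refl)) })
    ∷ ∉endpoints⇒untouched M (u∉ ∘ there ∘ there)

  edge : Fin n → Fin n → Pair n
  edge u x with toℕ x <? toℕ u
  ... | yes _ = (x , u)
  ... | no _  = (u , x)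

  edge-< : ∀ {u x} → toℕ x < toℕ u → edge u x ≡ (x , u)
  edge-< {u} {x} x<u with toℕ x <? toℕ u
  ... | yes _   = refl
  ... | no x≮u  = ⊥-elim (x≮u x<u)

  edge-≮ : ∀ {u x} → ¬ toℕ x < toℕ u → edge u x ≡ (u , x)
  edge-≮ {u} {x} x≮u with toℕ x <? toℕ u
  ... | yes x<u = ⊥-elim (x≮u x<u)
  ... | no _    = refl

  edge-injective : ∀ {u x y} → edge u x ≡ edge u y → x ≡ y
  edge-injective {u} {x} {y} eq with toℕ x <? toℕ u | toℕ y <? toℕ u
  ... | yes _   | yes _   = cong proj₁ eq
  ... | no _    | no _    = cong proj₂ eq
  ... | yes x<u | no _    = ⊥-elim (<-irrefl (cong (toℕ ∘ proj₁) eq) x<u)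
  ... | no _    | yes y<u = ⊥-elim (<-irrefl (cong (toℕ ∘ proj₁) (sym eq)) y<u)

module Isolation {n : ℕ} (a b : ℕ) (1≤b : 1 ≤ b) {u v : Fin n} (v≢u : v ≢ u) where

  makerToMove-untouched : ∀ {M B} → Untouched u M →
    (∀ Y → ValidMove a M B Y → BreakerToMove a b (Y ++ M) B) → MakerToMove a b M B
  makerToMove-untouched {M} {B} untouched respond with full⊎free M B
  ... | inj₁ full          = endM full (untouched⇒¬connected untouched v≢u)
  ... | inj₂ (_ , free)    = allM (λ full → full _ free) respond

  breakerWins-isolating : ∀ {M B} (C : List (Pair n)) → Unique C → length C ≤ b → Untouched u M →
    (∀ {e} → Free M B e → Incident u e → e ∈ C) → BreakerToMove a b M B
  breakerWins-isolating = go (<-wellFounded _)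
    where
      go : ∀ {M B} → Acc _<_ (length (freeEdges M B)) →
           (C : List (Pair n)) → Unique C → length C ≤ b → Untouched u M →
           (∀ {e} → Free M B e → Incident u e → e ∈ C) → BreakerToMove a b M B
      go {M} {B} (acc smaller) C uniqueC C≤b untouched covered with full⊎free M B
      ... | inj₁ full        = endB full (untouched⇒¬connected untouched v≢u)
      ... | inj₂ (x , freeX) = moveB (λ full → full x freeX) X validX
              (makerToMove-untouched untouched λ Y validY →
                 go (smaller (fewerFree Y)) [] AllPairs.[] z≤n
                    (Allₚ.++⁺ (All.map closed (claimsFree validY)) untouched)
                    (λ free → ⊥-elim ∘ closed (Free-++ Y [] free)))
        where
          P = filter (Free? M B) C
          move = extendMove b M B P (Unique.filter⁺ (Free? M B) uniqueC) (Allₚ.all-filter (Free? M B) C)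
                   (≤-trans (length-filter (Free? M B) C) C≤b)
          X = proj₁ move
          validX = proj₁ (proj₂ move)
          closed : ∀ {e} → Free M (X ++ B) e → ¬ Incident u e
          closed {e} free incident = proj₂ (proj₂ free) (∈-++⁺ˡ (proj₂ (proj₂ move)
            (∈-filter⁺ (Free? M B) (covered free′ incident) free′)))
            where free′ = Free-++ [] X free
          fewerFree : ∀ Y → length (freeEdges (Y ++ M) (X ++ B)) < length (freeEdges M B)
          fewerFree Y = let (y , y∈X) = claimsSome 1≤b validX freeX in
            length-filter-< (Free? (Y ++ M) (X ++ B)) (Free? M B) (Free-++ Y X)
              (∈-allPairs y) (All.lookup (claimsFree validX) y∈X) (λ free → proj₂ (proj₂ free) (∈-++⁺ˡ y∈X))

module Opening (m a b : ℕ) (1≤b : 1 ≤ b) (2a<n : 2 * a < 2 + m) (m≤b : m ≤ b) where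

  spokes : List (Pair (2 + m))
  spokes = map (λ k → (zero , suc (suc k))) (allFin m)

  firstMove : ∃ λ X → ValidMove b [] [] X × (∀ {e} → e ∈ spokes → e ∈ X)
  firstMove = extendMove b [] [] spokes
    (Unique.map⁺ (λ { refl → refl }) (Unique.allFin⁺ m))
    (Allₚ.map⁺ (All.tabulate λ _ → s≤s z≤n , (λ ()) , (λ ())))
    (subst (_≤ b) (sym (trans (length-map _ (allFin m)) (length-tabulate _))) m≤b)

  B₁ : List (Pair (2 + m))
  B₁ = proj₁ firstMove ++ []

  spoke∈B₁ : ∀ k → (zero , suc (suc k)) ∈ B₁
  spoke∈B₁ k = ∈-++⁺ˡ (proj₂ (proj₂ firstMove) (∈-map⁺ _ (∈-allFin k)))

  free-at-0 : ∀ {M e} → Free M B₁ e → Incident zero e → e ≡ (zero , suc zero)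
  free-at-0 {e = (_ , zero)}              (() , _)
  free-at-0 {e = (zero , suc zero)}       _              _ = refl
  free-at-0 {e = (zero , suc (suc k))}    (_ , _ , ∉B₁) _ = ⊥-elim (∉B₁ (spoke∈B₁ k))
  free-at-0 {e = (suc _ , suc _)}         _              (inj₁ ())
  free-at-0 {e = (suc _ , suc _)}         _              (inj₂ ())

  -- Maker cannot own {0,1} without touching 1.
  untouched-1⇒0 : ∀ {Y} → All (Free [] B₁) Y → Untouched (suc zero) Y → Untouched zero Y
  untouched-1⇒0 free ¬at1 = All.zipWith (λ (free , ¬at1) at0 →
    ¬at1 (subst (Incident (suc zero)) (sym (free-at-0 free at0)) (inj₂ refl))) (free , ¬at1)

  isolate-0 : ∀ {Y} → Untouched zero Y → BreakerToMove a b (Y ++ []) B₁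
  isolate-0 untouched = Isolation.breakerWins-isolating a b 1≤b {v = suc zero} (λ ())
    ((zero , suc zero) ∷ []) ([] AllPairs.∷ AllPairs.[]) 1≤b (Allₚ.++⁺ untouched [])
    (λ free at0 → here (free-at-0 free at0))

  module Spoke (k : Fin m) where
    u : Fin (2 + m)
    u = suc (suc k)

    nonzero : List (Fin (2 + m))
    nonzero = tabulate {n = 1 + m} suc

    ≢u? : Decidable (_≢ u)
    ≢u? x = ¬? (x ≟ u)

    star : List (Pair (2 + m))
    star = map (edge u) (filter ≢u? nonzero)

    star-unique : Unique star
    star-unique = Unique.map⁺ edge-injective (Unique.filter⁺ ≢u? (Unique.tabulate⁺ suc-injective))

    others<1+m : length (filter ≢u? nonzero) < 1 + m
    others<1+m = subst (length (filter ≢u? nonzero) <_) (length-tabulate {n = 1 + m} suc)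
      (filter-notAll ≢u? nonzero (Any.map (λ { refl u≢u → u≢u refl }) (∈-tabulate⁺ {f = suc} (suc k))))

    star≤b : length star ≤ b
    star≤b = ≤-trans (≤-reflexive (length-map (edge u) (filter ≢u? nonzero))) (≤-trans (≤-pred others<1+m) m≤b)

    ∈-star : ∀ {x} → suc x ≢ u → edge u (suc x) ∈ star
    ∈-star x≢u = ∈-map⁺ (edge u) (∈-filter⁺ ≢u? (∈-tabulate⁺ {f = suc} _) x≢u)

    free-at-u : ∀ {M e} → Free M B₁ e → Incident u e → e ∈ star
    free-at-u {e = (zero , _)}   (_ , _ , ∉B₁) (inj₂ refl) = ⊥-elim (∉B₁ (spoke∈B₁ k))
    free-at-u {e = (suc i , _)}  (i<u , _)     (inj₂ refl) =
      subst (_∈ star) (edge-< i<u) (∈-star λ i≡u → <-irrefl (cong toℕ i≡u) i<u)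
    free-at-u {e = (_ , zero)}   (() , _)      (inj₁ refl)
    free-at-u {e = (_ , suc j)}  (u<j , _)     (inj₁ refl) =
      subst (_∈ star) (edge-≮ (<-asym u<j)) (∈-star λ j≡u → <-irrefl (cong toℕ (sym j≡u)) u<j)

    isolate : ∀ {Y} → Untouched u Y → BreakerToMove a b (Y ++ []) B₁
    isolate untouched = Isolation.breakerWins-isolating a b 1≤b {v = zero} (λ ())
      star star-unique star≤b (Allₚ.++⁺ untouched []) free-at-u

  respond : ∀ Y → ValidMove a [] B₁ Y → BreakerToMove a b (Y ++ []) B₁
  respond Y validY with ∃∉ (endpoints Y) short
    where
      short : length (endpoints Y) < 2 + m
      short = ≤-<-trans (≤-trans (≤-reflexive (length-endpoints Y)) (*-monoʳ-≤ 2 (claimsAtMost validY))) 2a<n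
  ... | zero , ∉Y          = isolate-0 (∉endpoints⇒untouched Y ∉Y)
  ... | suc zero , ∉Y      = isolate-0 (untouched-1⇒0 (claimsFree validY) (∉endpoints⇒untouched Y ∉Y))
  ... | suc (suc k) , ∉Y   = Spoke.isolate k (∉endpoints⇒untouched Y ∉Y)

  breakerWins : BreakerWins (2 + m) a b
  breakerWins = moveB (λ full → full (zero , suc zero) (s≤s z≤n , (λ ()) , (λ ())))
    (proj₁ firstMove) (proj₁ (proj₂ firstMove))
    (Isolation.makerToMove-untouched a b 1≤b {u = zero} {v = suc zero} (λ ()) [] respond)

theorem1p3 : (n a b : ℕ) → 1 ≤ n → 1 ≤ a → 1 ≤ b →
    2 * a < n → n ≤ b + 2 → BreakerWins n a b
theorem1p3 (suc (suc m)) a b _ _ 1≤b 2a<n n≤b+2 =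
  Opening.breakerWins m a b 1≤b 2a<n (+-cancelʳ-≤ 2 m b (subst (_≤ b + 2) (+-comm 2 m) n≤b+2))
theorem1p3 zero          (suc a) _ _ _ _ ()        _
theorem1p3 (suc zero)    (suc a) _ _ _ _ (s≤s ()) _
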